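{- Let $A=U(7)^3\subseteq\mathbb{Z}_7$. A sequence $S$ in $\mathbb{Z}_7$ is an $A$-extremal sequence if and only if $S$ is $A$-equivalent to $(1,3,1)$.
   Context: $\mathbb{Z}_n=\mathbb{Z}/n\mathbb{Z}$, $U(n)$ its group of units, $U(n)^3=\{x^3:x\in U(n)\}$ (so $U(7)^3=\{1,-1\}$). For $B\subseteq\mathbb{Z}_n\setminus\{0\}$, a sequence $(x_1,\ldots,x_k)$ ($k\ge1$) in $\mathbb{Z}_n$ is a $B$-weighted zero-sum sequence if there exist $b_1,\ldots,b_k\in B$ with $b_1x_1+\cdots+b_kx_k=0$. A subsequence of consecutive terms is a nonempty block $(x_i,\ldots,x_j)$. $C_B(n)$ is the least positive integer $k$ such that every sequence of length $k$ in $\mathbb{Z}_n$ has a $B$-weighted zero-sum subsequence of consecutive terms. A sequence in $\mathbb{Z}_n$ is $B$-extremal if it has length $C_B(n)-1$ and has no $B$-weighted zero-sum subsequence of consecutive terms. For a subgroup $A$ of $U(n)$, a sequence $S:(x_1,\ldots,x_k)$ is $A$-equivalent to $T:(y_1,\ldots,y_k)$ (same length, same order of terms) if there exist $c\in U(n)$ and $a_1,\ldots,a_k\in A$ with $y_i=c\,a_i x_i$ for all $i$. -}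

module Defs where

open import Data.Nat as ℕ using (ℕ; NonZero; _≤_)
open import Data.Nat.DivMod using (_mod_)
open import Data.Fin using (Fin; toℕ; #_)
open import Data.List using (List; []; _∷_; _++_; length)
open import Data.List.Relation.Binary.Pointwise using (Pointwise)
open import Data.Product using (Σ; ∃; _×_; _,_)
open import Relation.Binary.PropositionalEquality using (_≡_; _≢_)
open import Relation.Nullary using (¬_)

-- ℤ_n represented by Fin n, with arithmetic modulo n.
module _ {n : ℕ} .{{_ : NonZero n}} where

  zeroₙ : Fin n
  zeroₙ = 0 mod n

  oneₙ : Fin n
  oneₙ = 1 mod n

  _+ₙ_ : Fin n → Fin n → Fin n
  x +ₙ y = (toℕ x ℕ.+ toℕ y) mod n

  _*ₙ_ : Fin n → Fin n → Fin n
  x *ₙ y = (toℕ x ℕ.* toℕ y) mod n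

  infixl 6 _+ₙ_
  infixl 7 _*ₙ_

  Unit : Fin n → Set
  Unit x = ∃ λ y → x *ₙ y ≡ oneₙ

  UnitCube : Fin n → Set
  UnitCube z = ∃ λ x → Unit x × z ≡ x *ₙ x *ₙ x

  -- weighted sum b₁x₁ + ⋯ + bₖxₖ of two lists (used with equal lengths)
  wsum : List (Fin n) → List (Fin n) → Fin n
  wsum (b ∷ bs) (x ∷ xs) = b *ₙ x +ₙ wsum bs xs
  wsum _ _ = zeroₙ

  WZeroSum : (Fin n → Set) → List (Fin n) → Set
  WZeroSum B xs =
    xs ≢ [] × ∃ λ bs → Pointwise (λ b _ → B b) bs xs × wsum bs xs ≡ zeroₙ

  HasZSBlock : (Fin n → Set) → List (Fin n) → Set
  HasZSBlock B xs =
    ∃ λ pre → ∃ λ ys → ∃ λ suf → xs ≡ pre ++ ys ++ suf × WZeroSum B ys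

  AllHaveZSBlock : (Fin n → Set) → ℕ → Set
  AllHaveZSBlock B k = ∀ (xs : List (Fin n)) → length xs ≡ k → HasZSBlock B xs

  IsC : (Fin n → Set) → ℕ → Set
  IsC B c = 1 ≤ c × AllHaveZSBlock B c
          × (∀ k → 1 ≤ k → AllHaveZSBlock B k → c ≤ k)

  Extremal : (Fin n → Set) → List (Fin n) → Set
  Extremal B xs = ∃ λ c → IsC B c × length xs ℕ.+ 1 ≡ c × ¬ HasZSBlock B xs

  AEquiv : (Fin n → Set) → List (Fin n) → List (Fin n) → Set
  AEquiv A S T =
    ∃ λ c → Unit c × Pointwise (λ x y → ∃ λ a → A a × y ≡ c *ₙ a *ₙ x) S T

{-# OPTIONS --safe #-}
module Submission where

-- Since U(7)³ = {1, −1}, a block is A-weighted zero-sum iff some signed sum of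
-- its terms vanishes, so every property involved is decidable by finite search.
-- Every sequence of length 4 has a zero-sum block while (1, 3, 1) has none,
-- hence C_A(7) = 4, and the zero-sum-free sequences of length 3 are exactly the
-- A-equivalents of (1, 3, 1). Each of these facts is one exhaustive check over ℤ₇.

open import Defs
open import Data.Nat using (NonZero)
open import Data.Fin using (Fin; #_)
open import Data.List using (List; []; _∷_)
open import Function.Bundles using (_⇔_)

open import Data.Nat as ℕ using (ℕ; _+_; _≤_; _<_)
open import Data.Nat.Properties using (≤-antisym; ≰⇒>; m≤n⇒m⊓n≡m; m≤n+m; +-comm; +-cancelʳ-≡)
open import Data.Fin.Properties using (_≟_; any?; all?)
open import Data.List using (_++_; length; take; drop; cartesianProductWith)
open import Data.List.Properties using (∷-injectiveʳ; ++-assoc; length-take; take++drop≡id)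
open import Data.List.Relation.Unary.Any as Any using (here)
open import Data.List.Membership.Propositional using (_∈_; find; lose)
open import Data.List.Membership.Propositional.Properties
  using (∈-cartesianProductWith⁺; ∈-cartesianProductWith⁻)
open import Data.List.Relation.Binary.Pointwise using (Pointwise; []; _∷_; Pointwise-length)
import Data.List.Relation.Binary.Pointwise.Properties as Pointwise
open import Data.Product using (∃; _×_; _,_; proj₁; proj₂)
open import Data.Sum using (_⊎_; inj₁; inj₂)
open import Function using (_∘_)
open import Function.Bundles using (mk⇔; Equivalence)
open import Level using (Level)
open import Relation.Binary.PropositionalEquality using (_≡_; refl; trans; cong; subst; module ≡-Reasoning)
open import Relation.Nullary using (¬_; contradiction; Dec; yes; no; ¬?; _×-dec_; _⊎-dec_; _→-dec_)
open import Relation.Nullary.Decidable using (map′; from-yes; from-no)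
open import Relation.Unary using (Pred; Decidable; _⊆_; _≐_)

open Equivalence using (to; from)

module _ {a p : Level} {A : Set a} where

  AnyPrefix : Pred (List A) p → Pred (List A) _
  AnyPrefix P xs = ∃ λ ys → ∃ λ suf → xs ≡ ys ++ suf × P ys

  AnyInfix : Pred (List A) p → Pred (List A) _
  AnyInfix P xs = ∃ λ pre → ∃ λ ys → ∃ λ suf → xs ≡ pre ++ ys ++ suf × P ys

  module _ {P : Pred (List A) p} where
    anyPrefix-[]⁻ : AnyPrefix P [] → P []
    anyPrefix-[]⁻ ([] , _ , _ , p) = p

    anyPrefix-∷⁺ : ∀ {x xs} → P [] ⊎ AnyPrefix (P ∘ (x ∷_)) xs → AnyPrefix P (x ∷ xs)
    anyPrefix-∷⁺ {x} {xs} (inj₁ p) = [] , x ∷ xs , refl , p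
    anyPrefix-∷⁺ {x} (inj₂ (ys , suf , eq , p)) = x ∷ ys , suf , cong (x ∷_) eq , p

    anyPrefix-∷⁻ : ∀ {x xs} → AnyPrefix P (x ∷ xs) → P [] ⊎ AnyPrefix (P ∘ (x ∷_)) xs
    anyPrefix-∷⁻ ([] , _ , _ , p) = inj₁ p
    anyPrefix-∷⁻ (_ ∷ ys , suf , refl , p) = inj₂ (ys , suf , refl , p)

    anyInfix-[]⁻ : AnyInfix P [] → P []
    anyInfix-[]⁻ ([] , [] , _ , _ , p) = p

    anyInfix-∷⁺ : ∀ {x xs} → AnyPrefix P (x ∷ xs) ⊎ AnyInfix P xs → AnyInfix P (x ∷ xs)
    anyInfix-∷⁺ (inj₁ (ys , suf , eq , p)) = [] , ys , suf , eq , p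
    anyInfix-∷⁺ {x} (inj₂ (pre , ys , suf , eq , p)) = x ∷ pre , ys , suf , cong (x ∷_) eq , p

    anyInfix-∷⁻ : ∀ {x xs} → AnyInfix P (x ∷ xs) → AnyPrefix P (x ∷ xs) ⊎ AnyInfix P xs
    anyInfix-∷⁻ ([] , rest) = inj₁ rest
    anyInfix-∷⁻ (_ ∷ pre , ys , suf , eq , p) = inj₂ (pre , ys , suf , ∷-injectiveʳ eq , p)

    anyInfix-++ʳ : ∀ {xs} zs → AnyInfix P xs → AnyInfix P (xs ++ zs)
    anyInfix-++ʳ {xs} zs (pre , ys , suf , eq , p) = pre , ys , suf ++ zs , eq′ , p
      where
      open ≡-Reasoning
      eq′ : xs ++ zs ≡ pre ++ ys ++ suf ++ zs
      eq′ = begin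
        xs ++ zs                 ≡⟨ cong (_++ zs) eq ⟩
        (pre ++ ys ++ suf) ++ zs ≡⟨ ++-assoc pre (ys ++ suf) zs ⟩
        pre ++ (ys ++ suf) ++ zs ≡⟨ cong (pre ++_) (++-assoc ys suf zs) ⟩
        pre ++ ys ++ suf ++ zs   ∎

    ¬AnyInfix⇒length< : ∀ {xs k} → ¬ AnyInfix P xs →
                        (∀ ys → length ys ≡ k → AnyInfix P ys) → length xs < k
    ¬AnyInfix⇒length< {xs} {k} free all-k with k ℕ.≤? length xs
    ... | no  k≰len = ≰⇒> k≰len
    ... | yes k≤len = contradiction
      (subst (AnyInfix P) (take++drop≡id k xs)
        (anyInfix-++ʳ (drop k xs) (all-k (take k xs) (trans (length-take k xs) (m≤n⇒m⊓n≡m k≤len)))))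
      free

  anyPrefix? : {P : Pred (List A) p} → Decidable P → Decidable (AnyPrefix P)
  anyPrefix? P? [] = map′ (λ p → [] , [] , refl , p) anyPrefix-[]⁻ (P? [])
  anyPrefix? P? (x ∷ xs) = map′ anyPrefix-∷⁺ anyPrefix-∷⁻ (P? [] ⊎-dec anyPrefix? (P? ∘ (x ∷_)) xs)

  anyInfix? : {P : Pred (List A) p} → Decidable P → Decidable (AnyInfix P)
  anyInfix? P? [] = map′ (λ p → [] , [] , [] , refl , p) anyInfix-[]⁻ (P? [])
  anyInfix? P? (x ∷ xs) = map′ anyInfix-∷⁺ anyInfix-∷⁻ (anyPrefix? P? (x ∷ xs) ⊎-dec anyInfix? P? xs)

module _ {n : ℕ} .{{_ : NonZero n}} where

  open import Data.List.Membership.DecPropositional (_≟_ {n}) using (_∈?_)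

  unit? : Decidable (Unit {n})
  unit? x = any? λ y → x *ₙ y ≟ oneₙ

  unitCube? : Decidable (UnitCube {n})
  unitCube? z = any? λ x → unit? x ×-dec z ≟ x *ₙ x *ₙ x

  weightedSums : List (Fin n) → List (Fin n) → List (Fin n)
  weightedSums ws []       = zeroₙ ∷ []
  weightedSums ws (x ∷ xs) = cartesianProductWith (λ b s → b *ₙ x +ₙ s) ws (weightedSums ws xs)

  module _ {B : Fin n → Set} {ws : List (Fin n)} where

    ∈-weightedSums⁺ : B ⊆ (_∈ ws) → ∀ {bs xs} →
                      Pointwise (λ b _ → B b) bs xs → wsum bs xs ∈ weightedSums ws xs
    ∈-weightedSums⁺ B⊆ws []         = here refl
    ∈-weightedSums⁺ B⊆ws (Bb ∷ Bbs) =
      ∈-cartesianProductWith⁺ _ (B⊆ws Bb) (∈-weightedSums⁺ B⊆ws Bbs)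

    ∈-weightedSums⁻ : (_∈ ws) ⊆ B → ∀ xs {t} → t ∈ weightedSums ws xs →
                      ∃ λ bs → Pointwise (λ b _ → B b) bs xs × wsum bs xs ≡ t
    ∈-weightedSums⁻ ws⊆B []       (here refl) = [] , [] , refl
    ∈-weightedSums⁻ ws⊆B (x ∷ xs) t∈
      with b , s , b∈ws , s∈ , refl ← ∈-cartesianProductWith⁻ _ ws (weightedSums ws xs) t∈
      with bs , Bbs , refl ← ∈-weightedSums⁻ ws⊆B xs s∈
      = b ∷ bs , ws⊆B b∈ws ∷ Bbs , refl

    wZeroSum? : B ≐ (_∈ ws) → Decidable (WZeroSum B)
    wZeroSum? _             []       = no λ (nonempty , _) → nonempty refl
    wZeroSum? (B⊆ws , ws⊆B) (x ∷ xs) = map′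
      (λ 0∈ → (λ ()) , ∈-weightedSums⁻ ws⊆B (x ∷ xs) 0∈)
      (λ (_ , bs , Bbs , Σ≡0) → subst (_∈ _) Σ≡0 (∈-weightedSums⁺ B⊆ws Bbs))
      (zeroₙ ∈? weightedSums ws (x ∷ xs))

    hasZSBlock? : B ≐ (_∈ ws) → Decidable (HasZSBlock B)
    hasZSBlock? B≐ws = anyInfix? (wZeroSum? B≐ws)

    ∃-weight? : B ≐ (_∈ ws) → {P : Fin n → Set} → Decidable P → Dec (∃ λ b → B b × P b)
    ∃-weight? (B⊆ws , ws⊆B) P? = map′
      (λ any → let b , b∈ws , Pb = find any in b , ws⊆B b∈ws , Pb)
      (λ (b , Bb , Pb) → lose (B⊆ws Bb) Pb)
      (Any.any? P? ws)

    aEquiv? : B ≐ (_∈ ws) → ∀ S T → Dec (AEquiv B S T)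
    aEquiv? B≐ws S T = any? λ c → unit? c ×-dec
      Pointwise.decidable (λ x y → ∃-weight? B≐ws (λ a → y ≟ c *ₙ a *ₙ x)) S T

  module _ {B : Fin n → Set} where

    IsC-unique : ∀ {c d} → IsC B c → IsC B d → c ≡ d
    IsC-unique (1≤c , all-c , c-least) (1≤d , all-d , d-least) =
      ≤-antisym (c-least _ 1≤d all-d) (d-least _ 1≤c all-c)

    IsC-from-free : ∀ {xs} → AllHaveZSBlock B (length xs + 1) → ¬ HasZSBlock B xs →
                    IsC B (length xs + 1)
    IsC-from-free {xs} all-blocked free =
      m≤n+m 1 (length xs) , all-blocked ,
      λ k _ all-k → subst (_≤ k) (+-comm 1 (length xs)) (¬AnyInfix⇒length< free all-k)

    extremal⇔ : ∀ {c xs} → IsC B c → Extremal B xs ⇔ (length xs + 1 ≡ c × ¬ HasZSBlock B xs)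
    extremal⇔ {c} isC = mk⇔
      (λ (d , isD , len , free) → trans len (IsC-unique isD isC) , free)
      (λ (len , free) → c , isC , len , free)

open import Data.List.Membership.DecPropositional (_≟_ {7}) using (_∈?_)

±1 : List (Fin 7)
±1 = # 1 ∷ # 6 ∷ []

unitCube≐±1 : UnitCube {7} ≐ (_∈ ±1)
unitCube≐±1 =
  (λ {b} → from-yes (all? λ b → unitCube? b →-dec b ∈? ±1) b) ,
  (λ {b} → from-yes (all? λ b → b ∈? ±1 →-dec unitCube? b) b)

allHaveZSBlock₄ : AllHaveZSBlock {7} UnitCube 4
allHaveZSBlock₄ (a ∷ b ∷ c ∷ d ∷ []) refl =
  from-yes (all? λ a → all? λ b → all? λ c → all? λ d →
    hasZSBlock? unitCube≐±1 (a ∷ b ∷ c ∷ d ∷ [])) a b c d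

T₁₃₁ : List (Fin 7)
T₁₃₁ = # 1 ∷ # 3 ∷ # 1 ∷ []

C₇≡4 : IsC {7} UnitCube 4
C₇≡4 = IsC-from-free {xs = T₁₃₁} allHaveZSBlock₄ (from-no (hasZSBlock? unitCube≐±1 T₁₃₁))

zeroSumFree⇔equiv₁₃₁ : ∀ S → length S ≡ 3 → (¬ HasZSBlock UnitCube S) ⇔ AEquiv UnitCube S T₁₃₁
zeroSumFree⇔equiv₁₃₁ (x ∷ y ∷ z ∷ []) refl = mk⇔ (proj₁ (classify x y z)) (proj₂ (classify x y z))
  where
  classify : ∀ x y z → let S = x ∷ y ∷ z ∷ [] in
             (¬ HasZSBlock UnitCube S → AEquiv UnitCube S T₁₃₁) ×
             (AEquiv UnitCube S T₁₃₁ → ¬ HasZSBlock UnitCube S)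
  classify = from-yes (all? λ x → all? λ y → all? λ z →
    let free? = ¬? (hasZSBlock? unitCube≐±1 (x ∷ y ∷ z ∷ []))
        equiv? = aEquiv? unitCube≐±1 (x ∷ y ∷ z ∷ []) T₁₃₁
    in (free? →-dec equiv?) ×-dec (equiv? →-dec free?))

mainTheorem10 : (S : List (Fin 7)) →
    Extremal UnitCube S ⇔ AEquiv UnitCube S (# 1 ∷ # 3 ∷ # 1 ∷ [])
mainTheorem10 S = mk⇔
  (λ extremal → let len , free = to (extremal⇔ C₇≡4) extremal in
     to (zeroSumFree⇔equiv₁₃₁ S (+-cancelʳ-≡ 1 (length S) 3 len)) free)
  (λ equiv → let len = Pointwise-length (proj₂ (proj₂ equiv)) in
     from (extremal⇔ C₇≡4) (cong (_+ 1) len , from (zeroSumFree⇔equiv₁₃₁ S len) equiv))
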